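{- Let $\mathbb{C}$ be a family equipped with a weak identity type structure. Then for every $n\in\mathbb{N}$, the family $\mathbb{C}^{\ast n}$ of length-$n$ telescopes has an identity type introduction structure, and for every $n,m\in\mathbb{N}$ there is a weak identity type elimination structure from $\mathbb{C}^{\ast n}$ to $\mathbb{C}^{\ast m}$ (with respect to these introduction structures).
   Context: A family $\mathbb{C}$ consists of a set $\mathbb{C}.\mathsf{Ty}$ of types and for each type $A$ a set $\mathbb{C}.\mathsf{Tm}(A)$ of terms (written $a:A$). The join $\mathbb{C}\ast\mathbb{D}$ of two families has types the pairs $(A,B)$ with $A:\mathbb{C}$ and $B$ a function from terms of $A$ to types of $\mathbb{D}$, and terms of $(A,B)$ the pairs $(a,b)$ with $a:A$, $b:B(a)$. $\mathbb{C}^{\ast n}$ is the $n$-fold iterated join of $\mathbb{C}$ (the join being a monoidal product with unit the family with one type having one term). An identity type introduction structure on $\mathbb{C}$ consists of types $\mathsf{Id}_A(x,y):\mathbb{C}$ for $x,y:A$ and terms $\mathsf{refl}:\mathsf{Id}_A(x,x)$; write $\mathsf{IdFrom}(x)=(y:A)\times\mathsf{Id}_A(x,y)$. Given families $\mathbb{C},\mathbb{D}$ with identity type introduction structures, a weak identity type elimination structure from $\mathbb{C}$ to $\mathbb{D}$ consists of operations $\mathsf{J}(A,x,D,d,p):D(p)$ for $A:\mathbb{C}$, $x:A$, $D:\mathsf{IdFrom}(x)\to\mathbb{D}.\mathsf{Ty}$, $d:D(x,\mathsf{refl})$, $p:\mathsf{IdFrom}(x)$, together with terms $\mathsf{J}_\beta(A,x,D,d):\mathsf{Id}(\mathsf{J}(A,x,D,d,(x,\mathsf{refl})),d)$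 (identity type of $\mathbb{D}$). A weak identity type structure on $\mathbb{C}$ is an introduction structure together with an elimination structure from $\mathbb{C}$ to $\mathbb{C}$. -}

module Defs where

open import Level using (Level; _⊔_; suc)
open import Data.Nat using (ℕ; zero; suc)
open import Data.Unit.Polymorphic using (⊤)
open import Data.Product using (Σ; _,_; proj₁; proj₂)

record Family (ℓ : Level) : Set (Level.suc ℓ) where
  field
    Ty : Set ℓ
    Tm : Ty → Set ℓ
open Family public

_∗_ : ∀ {ℓ} → Family ℓ → Family ℓ → Family ℓ
Ty (C ∗ D) = Σ (Ty C) (λ A → Tm C A → Ty D)
Tm (C ∗ D) (A , B) = Σ (Tm C A) (λ a → Tm D (B a))

𝟙F : ∀ {ℓ} → Family ℓ
Ty 𝟙F = ⊤
Tm 𝟙F _ = ⊤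

_^∗_ : ∀ {ℓ} → Family ℓ → ℕ → Family ℓ
C ^∗ zero = 𝟙F
C ^∗ suc n = C ∗ (C ^∗ n)

record IdIntro {ℓ} (C : Family ℓ) : Set ℓ where
  field
    Id   : (A : Ty C) → Tm C A → Tm C A → Ty C
    refl : (A : Ty C) (x : Tm C A) → Tm C (Id A x x)

  IdFrom : (A : Ty C) → Tm C A → Set ℓ
  IdFrom A x = Σ (Tm C A) (λ y → Tm C (Id A x y))
open IdIntro public

record WeakIdElim {ℓ} {C D : Family ℓ} (IC : IdIntro C) (ID : IdIntro D) : Set (Level.suc ℓ) where
  field
    J  : (A : Ty C) (x : Tm C A) (P : IdFrom IC A x → Ty D)
         (d : Tm D (P (x , refl IC A x))) (p : IdFrom IC A x) → Tm D (P p)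
    Jβ : (A : Ty C) (x : Tm C A) (P : IdFrom IC A x → Ty D)
         (d : Tm D (P (x , refl IC A x))) →
         Tm D (Id ID (P (x , refl IC A x)) (J A x P d (x , refl IC A x)) d)
open WeakIdElim public

record WeakIdStructure {ℓ} (C : Family ℓ) : Set (Level.suc ℓ) where
  field
    intro : IdIntro C
    elim  : WeakIdElim intro intro
open WeakIdStructure public

{-# OPTIONS --safe #-}
module Submission where

-- The identity type of a join X ∗ Y is taken to be Σ (p : a ≈ a') (transport p b ≈ b'),
-- with reflexivity (refl , transport-refl). Eliminators into and out of a join are then
-- assembled from eliminators on the components. Since the reflexivity of a join is not
-- (refl , refl), the computation rule forces a careful choice of the value at reflexivity:
-- it must be sent by J to a prescribed term at another point of IdFrom x, which is always
-- possible (J-surjective). Induction on n keeps, alongside the structure on C^{∗n},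
-- eliminators between C and C^{∗n} in both directions and from C^{∗n} to itself, which is
-- exactly what the join constructions consume.

open import Defs
open import Level using (Level)
open import Data.Nat using (ℕ; zero; suc)
open import Data.Product using (Σ; _,_; proj₁; proj₂)
open import Data.Unit.Polymorphic using (tt)

private
  variable
    ℓ : Level
    X Y Z : Family ℓ

Path : {C : Family ℓ} (I : IdIntro C) (A : Ty C) → Tm C A → Tm C A → Set ℓ
Path {C = C} I A x y = Tm C (Id I A x y)

module Transport {IX : IdIntro X} {IY : IdIntro Y} (E : WeakIdElim IX IY) where

  transport : (A : Ty X) (F : Tm X A → Ty Y) {s s' : Tm X A} →
              Path IX A s s' → Tm Y (F s) → Tm Y (F s')
  transport A F {s} {s'} e v = J E A s (λ u → F (proj₁ u)) v (s' , e)

  transport-refl : (A : Ty X) (F : Tm X A → Ty Y) {s : Tm X A} (v : Tm Y (F s)) →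
                   Path IY (F s) (transport A F (refl IX A s) v) v
  transport-refl A F {s} v = Jβ E A s (λ u → F (proj₁ u)) v

  ap : (A : Ty X) (B : Ty Y) (f : Tm X A → Tm Y B) {s s' : Tm X A} →
       Path IX A s s' → Path IY B (f s) (f s')
  ap A B f {s} {s'} e = J E A s (λ u → Id IY B (f s) (f (proj₁ u))) (refl IY B (f s)) (s' , e)

  apd : (A : Ty X) (F : Tm X A → Ty Y) (h : (s : Tm X A) → Tm Y (F s)) {s s' : Tm X A}
        (e : Path IX A s s') → Path IY (F s') (transport A F e (h s)) (h s')
  apd A F h {s} {s'} e =
    J E A s (λ u → Id IY (F (proj₁ u)) (transport A F (proj₂ u) (h s)) (h (proj₁ u)))
      (transport-refl A F (h s)) (s' , e)

  J-η : (A : Ty X) (x : Tm X A) (R : IdFrom IX A x → Ty Y)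
        (h : (v : IdFrom IX A x) → Tm Y (R v)) (v : IdFrom IX A x) →
        Path IY (R v) (J E A x R (h (x , refl IX A x)) v) (h v)
  J-η A x R h v =
    J E A x (λ u → Id IY (R u) (J E A x R (h (x , refl IX A x)) u) (h u))
      (Jβ E A x R (h (x , refl IX A x))) v

module PathAlgebra {I : IdIntro X} (E : WeakIdElim I I) where
  open Transport E public using (ap)

  trans : (A : Ty X) {x y z : Tm X A} → Path I A x y → Path I A y z → Path I A x z
  trans A {x} {y} {z} p q = J E A y (λ v → Id I A x (proj₁ v)) p (z , q)

  trans-reflʳ : (A : Ty X) {x y : Tm X A} (p : Path I A x y) →
                Path I (Id I A x y) (trans A p (refl I A y)) p
  trans-reflʳ A {x} {y} p = Jβ E A y (λ v → Id I A x (proj₁ v)) p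

  sym : (A : Ty X) {x y : Tm X A} → Path I A x y → Path I A y x
  sym A {x} {y} p = J E A x (λ v → Id I A (proj₁ v) x) (refl I A x) (y , p)

  sym-refl : (A : Ty X) (x : Tm X A) → Path I (Id I A x x) (sym A (refl I A x)) (refl I A x)
  sym-refl A x = Jβ E A x (λ v → Id I A (proj₁ v) x) (refl I A x)

  module ≈-Reasoning (A : Ty X) where
    infixr 2 _≈⟨_⟩_
    infix 3 _∎

    _≈⟨_⟩_ : (x : Tm X A) {y z : Tm X A} → Path I A x y → Path I A y z → Path I A x z
    _ ≈⟨ p ⟩ q = trans A p q

    _∎ : (x : Tm X A) → Path I A x x
    _∎ = refl I A

  trans-symˡ : (A : Ty X) {x y : Tm X A} (p : Path I A x y) →
               Path I (Id I A y y) (trans A (sym A p) p) (refl I A y)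
  trans-symˡ A {x} {y} p =
    J E A x (λ v → Id I (Id I A (proj₁ v) (proj₁ v))
                       (trans A (sym A (proj₂ v)) (proj₂ v)) (refl I A (proj₁ v)))
      (trans (Id I A x x) (trans-reflʳ A (sym A (refl I A x))) (sym-refl A x)) (y , p)

  trans-symʳ : (A : Ty X) {x y : Tm X A} (p : Path I A x y) →
               Path I (Id I A x x) (trans A p (sym A p)) (refl I A x)
  trans-symʳ A {x} {y} p =
    J E A x (λ v → Id I (Id I A x x) (trans A (proj₂ v) (sym A (proj₂ v))) (refl I A x))
      (trans (Id I A x x) (ap (Id I A x x) (Id I A x x) (trans A (refl I A x)) (sym-refl A x))
                          (trans-reflʳ A (refl I A x)))
      (y , p)

  trans-trans-sym : (A : Ty X) {x y z : Tm X A} (p : Path I A x y) (t : Path I A x z) →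
                    Path I (Id I A x z) t (trans A p (trans A (sym A p) t))
  trans-trans-sym A {x} {y} {z} p t =
    J E A x (λ v → Id I (Id I A x (proj₁ v)) (proj₂ v) (trans A p (trans A (sym A p) (proj₂ v))))
      (sym (Id I A x x) (trans (Id I A x x)
        (ap (Id I A y x) (Id I A x x) (trans A p) (trans-reflʳ A (sym A p)))
        (trans-symʳ A p)))
      (z , t)

module _ {IY : IdIntro Y} {IZ : IdIntro Z}
         (EYY : WeakIdElim IY IY) (EYZ : WeakIdElim IY IZ) (EZZ : WeakIdElim IZ IZ) where
  private
    module PY = PathAlgebra EYY
    module PZ = PathAlgebra EZZ
  open Transport EYZ

  transport-sym-transport : (A : Ty Y) (F : Tm Y A → Ty Z) {s s' : Tm Y A}
    (e : Path IY A s s') (v : Tm Z (F s)) →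
    Path IZ (F s) (transport A F (PY.sym A e) (transport A F e v)) v
  transport-sym-transport A F {s} {s'} e v =
    J EYZ A s (λ u → Id IZ (F s) (transport A F (PY.sym A (proj₂ u)) (transport A F (proj₂ u) v)) v)
      base (s' , e)
    where
      open PZ.≈-Reasoning (F s)
      rfl = refl IY A s
      base : Path IZ (F s) (transport A F (PY.sym A rfl) (transport A F rfl v)) v
      base = transport A F (PY.sym A rfl) (transport A F rfl v)
               ≈⟨ PZ.ap (F s) (F s) (transport A F (PY.sym A rfl)) (transport-refl A F v) ⟩
             transport A F (PY.sym A rfl) v
               ≈⟨ ap (Id IY A s s) (F s) (λ e → transport A F e v) (PY.sym-refl A s) ⟩
             transport A F rfl v
               ≈⟨ transport-refl A F v ⟩
             v ∎

  -- Extend w to a section h of R by eliminating from y, reaching (z , t) from (y , q)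
  -- along q ∙ (q⁻¹ ∙ t) ≈ t; then J R (h (x , refl)) agrees with h everywhere.
  J-surjective : (A : Ty Y) (x : Tm Y A) (R : IdFrom IY A x → Ty Z)
    {y : Tm Y A} (q : Path IY A x y) (w : Tm Z (R (y , q))) →
    Σ (Tm Z (R (x , refl IY A x))) λ c → Path IZ (R (y , q)) (J EYZ A x R c (y , q)) w
  J-surjective A x R {y} q w = h (x , refl IY A x) , hits
    where
      q⁻¹∙_ : {z : Tm Y A} → Path IY A x z → Path IY A y z
      q⁻¹∙ t = PY.trans A (PY.sym A q) t

      R-at : (z : Tm Y A) → Path IY A x z → Ty Z
      R-at z t = R (z , t)

      R-from-y : IdFrom IY A y → Ty Z
      R-from-y (z , s) = R (z , PY.trans A q s)

      u : Tm Z (R (y , PY.trans A q (q⁻¹∙ q)))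
      u = transport (Id IY A x y) (R-at y) (PY.trans-trans-sym A q q) w

      w-refl : Tm Z (R-from-y (y , refl IY A y))
      w-refl = transport (Id IY A y y) (λ s → R-from-y (y , s)) (PY.trans-symˡ A q) u

      S : (v : IdFrom IY A y) → Tm Z (R-from-y v)
      S = J EYZ A y R-from-y w-refl

      h : (v : IdFrom IY A x) → Tm Z (R v)
      h (z , t) = transport (Id IY A x z) (R-at z) (PY.sym (Id IY A x z) (PY.trans-trans-sym A q t))
                    (S (z , q⁻¹∙ t))

      back : Tm Z (R (y , PY.trans A q (q⁻¹∙ q))) → Tm Z (R (y , q))
      back = transport (Id IY A x y) (R-at y) (PY.sym (Id IY A x y) (PY.trans-trans-sym A q q))

      down : Tm Z (R-from-y (y , refl IY A y)) → Tm Z (R-from-y (y , q⁻¹∙ q))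
      down = transport (Id IY A y y) (λ s → R-from-y (y , s)) (PY.sym (Id IY A y y) (PY.trans-symˡ A q))

      open PZ.≈-Reasoning (R (y , q))
      hits : Path IZ (R (y , q)) (J EYZ A x R (h (x , refl IY A x)) (y , q)) w
      hits = J EYZ A x R (h (x , refl IY A x)) (y , q)
               ≈⟨ J-η A x R h (y , q) ⟩
             back (S (y , q⁻¹∙ q))
               ≈⟨ PZ.ap _ _ back (PZ.sym _ (apd (Id IY A y y) (λ s → R-from-y (y , s)) (λ s → S (y , s))
                                                 (PY.sym (Id IY A y y) (PY.trans-symˡ A q)))) ⟩
             back (down (S (y , refl IY A y)))
               ≈⟨ PZ.ap _ _ (λ s → back (down s)) (Jβ EYZ A y R-from-y w-refl) ⟩
             back (down w-refl)
               ≈⟨ PZ.ap _ _ back (transport-sym-transport (Id IY A y y) (λ s → R-from-y (y , s)) (PY.trans-symˡ A q) u) ⟩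
             back u
               ≈⟨ transport-sym-transport (Id IY A x y) (R-at y) (PY.trans-trans-sym A q q) w ⟩
             w ∎

joinIdIntro : {IX : IdIntro X} {IY : IdIntro Y} → WeakIdElim IX IY → IdIntro (X ∗ Y)
Id (joinIdIntro {IX = IX} {IY} E) (A , B) (a , b) (a' , b') =
  Id IX A a a' , λ p → Id IY (B a') (Transport.transport E A B p b) b'
refl (joinIdIntro {IX = IX} E) (A , B) (a , b) =
  refl IX A a , Transport.transport-refl E A B b

module _ {IX : IdIntro X} {IY : IdIntro Y} {IZ : IdIntro Z}
         (EXY : WeakIdElim IX IY) (EXZ : WeakIdElim IX IZ) (EYZ : WeakIdElim IY IZ)
         (EYY : WeakIdElim IY IY) (EZZ : WeakIdElim IZ IZ) where
  private
    module PZ = PathAlgebra EZZ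

    module _ (A : Ty X) (x : Tm X A) (P : IdFrom IX A x → Ty (Y ∗ Z))
             (d : Tm (Y ∗ Z) (P (x , refl IX A x))) where
      P₁ : IdFrom IX A x → Ty Y
      P₁ v = proj₁ (P v)

      P₂ : (v : IdFrom IX A x) → Tm Y (P₁ v) → Ty Z
      P₂ v = proj₂ (P v)

      r : IdFrom IX A x
      r = x , refl IX A x

      J₁ : (v : IdFrom IX A x) → Tm Y (P₁ v)
      J₁ = J EXY A x P₁ (proj₁ d)

      J₁-β : Path IY (P₁ r) (J₁ r) (proj₁ d)
      J₁-β = Jβ EXY A x P₁ (proj₁ d)

      centre : Σ (Tm Z (P₂ r (J₁ r))) λ c →
               Path IZ (P₂ r (proj₁ d)) (Transport.transport EYZ (P₁ r) (P₂ r) J₁-β c) (proj₂ d)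
      centre = J-surjective EYY EYZ EZZ (P₁ r) (J₁ r) (λ u → P₂ r (proj₁ u)) J₁-β (proj₂ d)

      J₂ : (v : IdFrom IX A x) → Tm Z (P₂ v (J₁ v))
      J₂ = J EXZ A x (λ v → P₂ v (J₁ v)) (proj₁ centre)

      J-join : (v : IdFrom IX A x) → Tm (Y ∗ Z) (P v)
      J-join v = J₁ v , J₂ v

      J-join-β : Path (joinIdIntro EYZ) (P r) (J-join r) d
      J-join-β = J₁-β , PZ.trans (P₂ r (proj₁ d))
        (PZ.ap (P₂ r (J₁ r)) (P₂ r (proj₁ d)) (Transport.transport EYZ (P₁ r) (P₂ r) J₁-β)
               (Jβ EXZ A x (λ v → P₂ v (J₁ v)) (proj₁ centre)))
        (proj₂ centre)

  elim-into-join : WeakIdElim IX (joinIdIntro EYZ)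
  J elim-into-join = J-join
  Jβ elim-into-join = J-join-β

module _ {IX : IdIntro X} {IY : IdIntro Y} {IZ : IdIntro Z}
         (EXY : WeakIdElim IX IY) (EXZ : WeakIdElim IX IZ) (EYZ : WeakIdElim IY IZ)
         (EYY : WeakIdElim IY IY) (EZZ : WeakIdElim IZ IZ) where
  private
    module PZ = PathAlgebra EZZ

    module _ (AB : Ty (X ∗ Y)) (ab : Tm (X ∗ Y) AB) (P : IdFrom (joinIdIntro EXY) AB ab → Ty Z)
             (d : Tm Z (P (ab , refl (joinIdIntro EXY) AB ab))) where
      A : Ty X
      A = proj₁ AB

      B : Tm X A → Ty Y
      B = proj₂ AB

      a : Tm X A
      a = proj₁ ab

      b : Tm Y (B a)
      b = proj₂ ab

      b↑ : {a' : Tm X A} → Path IX A a a' → Tm Y (B a')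
      b↑ p = Transport.transport EXY A B p b

      b₀ : Tm Y (B a)
      b₀ = b↑ (refl IX A a)

      β₀ : Path IY (B a) b₀ b
      β₀ = Transport.transport-refl EXY A B b

      R₀ : IdFrom IY (B a) b₀ → Ty Z
      R₀ (b' , e) = P ((a , b') , (refl IX A a , e))

      centre : Σ (Tm Z (R₀ (b₀ , refl IY (B a) b₀))) λ c → Path IZ (R₀ (b , β₀)) (J EYZ (B a) b₀ R₀ c (b , β₀)) d
      centre = J-surjective EYY EYZ EZZ (B a) b₀ R₀ β₀ d

      Q : IdFrom IX A a → Ty Z
      Q (a' , p) = P ((a' , b↑ p) , (p , refl IY (B a') (b↑ p)))

      J-join : (v : IdFrom (joinIdIntro EXY) AB ab) → Tm Z (P v)
      J-join ((a' , b') , (p , e)) =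
        J EYZ (B a') (b↑ p) (λ (b″ , e′) → P ((a' , b″) , (p , e′))) (J EXZ A a Q (proj₁ centre) (a' , p)) (b' , e)

      J-join-β : Path IZ (R₀ (b , β₀)) (J-join (ab , refl (joinIdIntro EXY) AB ab)) d
      J-join-β = PZ.trans (R₀ (b , β₀))
        (PZ.ap (R₀ (b₀ , refl IY (B a) b₀)) (R₀ (b , β₀)) (λ c → J EYZ (B a) b₀ R₀ c (b , β₀))
               (Jβ EXZ A a Q (proj₁ centre)))
        (proj₂ centre)

  elim-from-join : WeakIdElim (joinIdIntro EXY) IZ
  J elim-from-join = J-join
  Jβ elim-from-join = J-join-β

𝟙-idIntro : IdIntro (𝟙F {ℓ})
Id 𝟙-idIntro _ _ _ = tt
refl 𝟙-idIntro _ _ = tt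

elim-into-𝟙 : {IX : IdIntro X} → WeakIdElim IX (𝟙-idIntro {ℓ})
J elim-into-𝟙 _ _ _ _ _ = tt
Jβ elim-into-𝟙 _ _ _ _ = tt

elim-from-𝟙 : {IX : IdIntro X} → WeakIdElim (𝟙-idIntro {ℓ}) IX
J elim-from-𝟙 _ _ _ d _ = d
Jβ (elim-from-𝟙 {IX = IX}) _ x P d = refl IX (P (x , tt)) d

module Telescopes (C : Family ℓ) (W : WeakIdStructure C) where
  private
    IC : IdIntro C
    IC = intro W

    EC : WeakIdElim IC IC
    EC = elim W

  record TelescopeLevel (n : ℕ) : Set (Level.suc ℓ) where
    field
      idIntro     : IdIntro (C ^∗ n)
      elim-from-C : WeakIdElim IC idIntro
      elim-to-C   : WeakIdElim idIntro IC
      elim-self   : WeakIdElim idIntro idIntro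
  open TelescopeLevel

  level : (n : ℕ) → TelescopeLevel n
  level zero = record
    { idIntro     = 𝟙-idIntro
    ; elim-from-C = elim-into-𝟙
    ; elim-to-C   = elim-from-𝟙
    ; elim-self   = elim-into-𝟙
    }
  level (suc n) = record
    { idIntro     = joinIdIntro from-C
    ; elim-from-C = elim-into-join EC from-C from-C EC self
    ; elim-to-C   = to-C
    ; elim-self   = elim-into-join to-C (elim-from-join from-C from-C self self self) from-C EC self
    }
    where
      from-C : WeakIdElim IC (idIntro (level n))
      from-C = elim-from-C (level n)

      self : WeakIdElim (idIntro (level n)) (idIntro (level n))
      self = elim-self (level n)

      to-C : WeakIdElim (joinIdIntro from-C) IC
      to-C = elim-from-join from-C EC (elim-to-C (level n)) self EC

  idIntro-^∗ : (n : ℕ) → IdIntro (C ^∗ n)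
  idIntro-^∗ n = idIntro (level n)

  elim-^∗ : (n m : ℕ) → WeakIdElim (idIntro-^∗ n) (idIntro-^∗ m)
  elim-^∗ n zero = elim-into-𝟙
  elim-^∗ n (suc m) =
    elim-into-join (elim-to-C (level n)) (elim-^∗ n m) (elim-from-C (level m)) EC (elim-self (level m))

mainTheorem6 : ∀ {ℓ : Level} (C : Family ℓ) → WeakIdStructure C →
    Σ ((n : ℕ) → IdIntro (C ^∗ n))
    (λ I → (n m : ℕ) → WeakIdElim (I n) (I m))
mainTheorem6 C W = idIntro-^∗ , elim-^∗
  where open Telescopes C W
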